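{- Let $\lambda$ be a nonzero complex number and $F=\dfrac{1}{(1+t)^{\lambda}+1}\in\mathbb{C}[[t]]$. For each integer $N\ge0$ let $a_0(N;\lambda),\dots,a_N(N;\lambda)$ be the unique constants such that \[ \left(\frac{d}{dt}\right)^{N}F=\frac{(-1)^{N}\lambda}{(1+t)^{N}}\sum_{i=1}^{N+1}a_{i-1}(N;\lambda)F^{i}. \] Then for all $N\in\mathbb{N}$ and all integers $k\ge0$, \[ Bl_{k+N}(\lambda)=(-1)^N\lambda\sum_{i=1}^{N+1}a_{i-1}(N;\lambda)\sum_{l=0}^{k}\binom{k}{l}(-1)^l(N+l-1)_l\,Bl^{(i)}_{k-l}(\lambda). \]
   Context: $(1+t)^{\lambda}=\sum_{n\ge0}\binom{\lambda}{n}t^n$. The Boole numbers $Bl_n(\lambda)$ are defined by $\frac{1}{(1+t)^{\lambda}+1}=\sum_{n\ge0}Bl_n(\lambda)\frac{t^n}{n!}$, and the higher-order Boole numbers $Bl_n^{(r)}(\lambda)$, $r\in\mathbb{N}$, by $\left(\frac{1}{1+(1+t)^{\lambda}}\right)^{r}=\sum_{n\ge0}Bl^{(r)}_n(\lambda)\frac{t^n}{n!}$. The falling factorial is $(x)_n=x(x-1)\cdots(x-n+1)$, $(x)_0=1$. -}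

module Defs where

open import Level using (Level; _⊔_) renaming (suc to lsuc)
open import Algebra.Bundles using (CommutativeRing)
open import Data.Nat using (ℕ; zero; suc; _∸_; _≤?_; _!)
open import Relation.Nullary using (¬_; yes; no)

fromℕ : ∀ {c ℓ} (R : CommutativeRing c ℓ) → ℕ → CommutativeRing.Carrier R
fromℕ R zero    = CommutativeRing.0# R
fromℕ R (suc n) = CommutativeRing._+_ R (CommutativeRing.1# R) (fromℕ R n)

-- A field of characteristic zero (ℂ is an instance).  The inverse is a total
-- operation which is a genuine inverse on nonzero elements.
record CharZeroField (c ℓ : Level) : Set (lsuc (c ⊔ ℓ)) where
  field
    cring : CommutativeRing c ℓ
  open CommutativeRing cring public
  field
    inv      : Carrier → Carrier
    inv-law  : ∀ x → ¬ (x ≈ 0#) → x * inv x ≈ 1#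
    charZero : ∀ n → ¬ (fromℕ cring (suc n) ≈ 0#)

module Series {c ℓ : Level} (K : CharZeroField c ℓ) where
  open CharZeroField K

  fromℕK : ℕ → Carrier
  fromℕK = fromℕ cring

  -- formal power series in t: n ↦ coefficient of t^n
  Series : Set c
  Series = ℕ → Carrier

  _≋_ : Series → Series → Set ℓ
  f ≋ g = ∀ n → f n ≈ g n

  Σ< : ℕ → (ℕ → Carrier) → Carrier
  Σ< zero    f = 0#
  Σ< (suc n) f = Σ< n f + f n

  sgn : ℕ → Carrier
  sgn zero    = 1#
  sgn (suc n) = - sgn n

  falling : Carrier → ℕ → Carrier
  falling x zero    = 1#
  falling x (suc n) = falling x n * (x - fromℕK n)

  binom : Carrier → ℕ → Carrier
  binom x n = falling x n * inv (fromℕK (n !))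

  oneS : Series
  oneS zero    = 1#
  oneS (suc n) = 0#

  onePlusT : Series
  onePlusT zero          = 1#
  onePlusT (suc zero)    = 1#
  onePlusT (suc (suc n)) = 0#

  _⊕_ : Series → Series → Series
  (f ⊕ g) n = f n + g n

  _·_ : Carrier → Series → Series
  (a · f) n = a * f n

  _⊛_ : Series → Series → Series
  (f ⊛ g) n = Σ< (suc n) (λ i → f i * g (n ∸ i))

  powS : Series → ℕ → Series
  powS f zero    = oneS
  powS f (suc r) = f ⊛ powS f r

  deriv : Series → Series
  deriv f n = fromℕK (suc n) * f (suc n)

  derivN : ℕ → Series → Series
  derivN zero    f = f
  derivN (suc N) f = deriv (derivN N f)

  -- reciprocal of a series g with invertible constant term:
  -- h 0 = 1/g 0,  h n = -(1/g 0) Σ_{i=1}^{n} g i h (n-i).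
  -- recipPre g n agrees with the reciprocal on indices ≤ n.
  recipPre : Series → ℕ → Series
  recipPre g zero    m = inv (g 0)
  recipPre g (suc n) m with m ≤? n
  ... | yes _ = recipPre g n m
  ... | no  _ = - (inv (g 0) * Σ< (suc n) (λ j → g (suc j) * recipPre g n (n ∸ j)))

  recip : Series → Series
  recip g n = recipPre g n n

  -- (1+t)^λ = Σ binom(λ,n) t^n
  binSeries : Carrier → Series
  binSeries x n = binom x n

  F : Carrier → Series
  F x = recip (binSeries x ⊕ oneS)

  -- Boole numbers:  1/((1+t)^λ+1) = Σ Bl_n(λ) t^n/n!
  Bl : ℕ → Carrier → Carrier
  Bl n x = fromℕK (n !) * F x n

  -- higher-order Boole numbers: (1/(1+(1+t)^λ))^r = Σ Bl^{(r)}_n(λ) t^n/n!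
  BlHigh : ℕ → ℕ → Carrier → Carrier
  BlHigh r n x = fromℕK (n !) * powS (recip (oneS ⊕ binSeries x)) r n

module Submission where

-- Write F = 1/((1+t)^λ + 1) and let G = Σ_i a_i F^(i+1).  The hypothesis says
-- D^N F = (-1)^N λ (1+t)^(-N) G.  Reading off the coefficient of t^k and
-- multiplying by k! turns every series into its exponential coefficients:
--   * k! [t^k] D^N F        = (k+N)! [t^(k+N)] F  = Bl_(k+N)(λ);
--   * k! [t^k] (f g)        = Σ_l C(k,l) (l! [t^l] f) ((k-l)! [t^(k-l)] g);
--   * l! [t^l] (1+t)^(-N)   = (-1)^l (N+l-1)_l;
--   * m! [t^m] F^r          = Bl^(r)_m(λ).
-- The theorem is these four facts followed by an exchange of two finite sums.
--
-- The third fact follows by induction on N and l from the recurrence given by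
-- (1+t)·(1+t)^(-(N+1)) = (1+t)^(-N), which the falling factorials also satisfy.

open import Defs
open import Level using (Level)
open import Data.Nat as ℕ using (ℕ; zero; suc; _∸_; _≤_; _<_; z≤n; s≤s; _!)
  renaming (_+_ to _+ℕ_; _*_ to _*ℕ_)
import Data.Nat.Properties as ℕP
open import Data.Nat.Combinatorics using (_C_; nCk≡n!/k![n-k]!; k![n∸k]!∣n!)
open import Data.Nat.DivMod using (m/n*n≡m)
open import Data.Sum using (inj₁; inj₂)
open import Data.Empty using (⊥-elim)
open import Relation.Nullary using (¬_; yes; no)
open import Relation.Binary.PropositionalEquality as ≡ using (_≡_)
import Algebra.Properties.Ring as RingProperties
import Algebra.Properties.AbelianGroup as AbelianGroupProperties
import Algebra.Properties.Group as GroupProperties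
import Algebra.Properties.CommutativeSemigroup as CommutativeSemigroupProperties
import Algebra.Properties.Semiring.Mult as SemiringMult

factorial-split : ∀ {k l} → l ≤ k → k ! ≡ ((k C l) *ℕ l !) *ℕ (k ∸ l) !
factorial-split {k} {l} l≤k = begin
  k !                                     ≡⟨ m/n*n≡m (k![n∸k]!∣n! l≤k) ⟨
  (k ! ℕ./ (l ! *ℕ (k ∸ l) !)) *ℕ (l ! *ℕ (k ∸ l) !)
                                          ≡⟨ ≡.cong (_*ℕ (l ! *ℕ (k ∸ l) !)) (nCk≡n!/k![n-k]! l≤k) ⟨
  (k C l) *ℕ (l ! *ℕ (k ∸ l) !)           ≡⟨ ℕP.*-assoc (k C l) (l !) ((k ∸ l) !) ⟨
  ((k C l) *ℕ l !) *ℕ (k ∸ l) !           ∎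
  where
  open ≡.≡-Reasoning
  instance
    l!*[k-l]!≢0 : ℕ.NonZero (l ! *ℕ (k ∸ l) !)
    l!*[k-l]!≢0 = ℕP._!*_!≢0 l (k ∸ l)

module Development {c ℓ : Level} (K : CharZeroField c ℓ) where
  open CharZeroField K hiding (zero)
  open Series K
  open import Relation.Binary.Reasoning.Setoid setoid
  open RingProperties ring using (-‿distribˡ-*; -‿distribʳ-*)
  open AbelianGroupProperties +-abelianGroup using (⁻¹-∙-comm)
  open GroupProperties +-group using (ε⁻¹≈ε; //-rightDividesˡ; //-rightDividesʳ; ∙-cancelʳ)
  open CommutativeSemigroupProperties +-commutativeSemigroup using (interchange)
  open CommutativeSemigroupProperties *-commutativeSemigroup
    using () renaming (interchange to *-interchange; x∙yz≈y∙xz to *-left-swap)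
  open SemiringMult semiring using (_×_; ×-homo-+; ×1-homo-*)

  Σ-cong< : ∀ n {f g : ℕ → Carrier} → (∀ i → i < n → f i ≈ g i) → Σ< n f ≈ Σ< n g
  Σ-cong< zero    e = refl
  Σ-cong< (suc n) e = +-cong (Σ-cong< n (λ i i<n → e i (ℕP.m<n⇒m<1+n i<n))) (e n ℕP.≤-refl)

  Σ-cong : ∀ n {f g : ℕ → Carrier} → (∀ i → f i ≈ g i) → Σ< n f ≈ Σ< n g
  Σ-cong n e = Σ-cong< n (λ i _ → e i)

  Σ-zero : ∀ n {f : ℕ → Carrier} → (∀ i → f i ≈ 0#) → Σ< n f ≈ 0#
  Σ-zero zero    e = refl
  Σ-zero (suc n) e = trans (+-cong (Σ-zero n e) (e n)) (+-identityˡ 0#)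

  Σ-first : ∀ n (f : ℕ → Carrier) → Σ< (suc n) f ≈ f 0 + Σ< n (λ i → f (suc i))
  Σ-first zero    f = trans (+-identityˡ _) (sym (+-identityʳ _))
  Σ-first (suc n) f = trans (+-congʳ (Σ-first n f)) (+-assoc _ _ _)

  Σ-+ : ∀ n (f g : ℕ → Carrier) → Σ< n (λ i → f i + g i) ≈ Σ< n f + Σ< n g
  Σ-+ zero    f g = sym (+-identityˡ 0#)
  Σ-+ (suc n) f g = trans (+-congʳ (Σ-+ n f g)) (interchange _ _ _ _)

  Σ-*ˡ : ∀ n a (f : ℕ → Carrier) → a * Σ< n f ≈ Σ< n (λ i → a * f i)
  Σ-*ˡ zero    a f = zeroʳ a
  Σ-*ˡ (suc n) a f = trans (distribˡ a _ _) (+-congʳ (Σ-*ˡ n a f))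

  Σ-*ʳ : ∀ n a (f : ℕ → Carrier) → Σ< n f * a ≈ Σ< n (λ i → f i * a)
  Σ-*ʳ n a f = trans (*-comm _ a) (trans (Σ-*ˡ n a f) (Σ-cong n (λ i → *-comm a (f i))))

  Σ-swap : ∀ n m (A : ℕ → ℕ → Carrier) →
           Σ< n (λ i → Σ< m (λ j → A i j)) ≈ Σ< m (λ j → Σ< n (λ i → A i j))
  Σ-swap zero    m A = sym (Σ-zero m (λ _ → refl))
  Σ-swap (suc n) m A = trans (+-congʳ (Σ-swap n m A)) (sym (Σ-+ m _ _))

  Σ-swap-weighted : ∀ n m (w a : ℕ → Carrier) (B : ℕ → ℕ → Carrier) →
    Σ< m (λ l → w l * Σ< n (λ i → a i * B i l)) ≈ Σ< n (λ i → a i * Σ< m (λ l → w l * B i l))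
  Σ-swap-weighted n m w a B = begin
    Σ< m (λ l → w l * Σ< n (λ i → a i * B i l))  ≈⟨ Σ-cong m (λ l → Σ-*ˡ n (w l) _) ⟩
    Σ< m (λ l → Σ< n (λ i → w l * (a i * B i l))) ≈⟨ Σ-swap m n _ ⟩
    Σ< n (λ i → Σ< m (λ l → w l * (a i * B i l))) ≈⟨ Σ-cong n (λ i → Σ-cong m (λ l → *-left-swap _ _ _)) ⟩
    Σ< n (λ i → Σ< m (λ l → a i * (w l * B i l))) ≈⟨ Σ-cong n (λ i → sym (Σ-*ˡ m (a i) _)) ⟩
    Σ< n (λ i → a i * Σ< m (λ l → w l * B i l))   ∎

  Σ-reverse : ∀ m (h : ℕ → Carrier) → Σ< m h ≈ Σ< m (λ i → h (m ∸ suc i))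
  Σ-reverse zero    h = refl
  Σ-reverse (suc m) h = begin
    Σ< m h + h m                     ≈⟨ +-congʳ (Σ-reverse m h) ⟩
    Σ< m (λ i → h (m ∸ suc i)) + h m ≈⟨ +-comm _ _ ⟩
    h m + Σ< m (λ i → h (m ∸ suc i)) ≈⟨ Σ-first m (λ i → h (m ∸ i)) ⟨
    Σ< (suc m) (λ i → h (m ∸ i))     ∎

  Σ-triangle : ∀ n (A : ℕ → ℕ → Carrier) →
    Σ< (suc n) (λ i → Σ< (suc i) (λ j → A j i)) ≈
    Σ< (suc n) (λ j → Σ< (suc (n ∸ j)) (λ m → A j (j +ℕ m)))
  Σ-triangle zero    A = refl
  Σ-triangle (suc n) A = begin
    Σ< (suc n) (λ i → Σ< (suc i) (λ j → A j i)) + (Σ< (suc n) (λ j → A j (suc n)) + A (suc n) (suc n))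
      ≈⟨ +-congʳ (Σ-triangle n A) ⟩
    Σ< (suc n) inner + (Σ< (suc n) (λ j → A j (suc n)) + A (suc n) (suc n))
      ≈⟨ +-assoc _ _ _ ⟨
    (Σ< (suc n) inner + Σ< (suc n) (λ j → A j (suc n))) + A (suc n) (suc n)
      ≈⟨ +-cong (sym (Σ-+ (suc n) _ _)) (sym diagonal) ⟩
    Σ< (suc n) (λ j → inner j + A j (suc n)) + Σ< (suc (n ∸ n)) (λ m → A (suc n) (suc n +ℕ m))
      ≈⟨ +-congʳ (Σ-cong< (suc n) extendRow) ⟩
    Σ< (suc n) (λ j → Σ< (suc (suc n ∸ j)) (λ m → A j (j +ℕ m))) + Σ< (suc (n ∸ n)) (λ m → A (suc n) (suc n +ℕ m)) ∎
    where
    inner : ℕ → Carrier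
    inner j = Σ< (suc (n ∸ j)) (λ m → A j (j +ℕ m))
    -- the new row j = n+1 consists of the single entry A (n+1) (n+1)
    diagonal : Σ< (suc (n ∸ n)) (λ m → A (suc n) (suc n +ℕ m)) ≈ A (suc n) (suc n)
    diagonal = begin
      Σ< (suc (n ∸ n)) (λ m → A (suc n) (suc n +ℕ m)) ≡⟨ ≡.cong (λ r → Σ< (suc r) (λ m → A (suc n) (suc n +ℕ m))) (ℕP.n∸n≡0 n) ⟩
      0# + A (suc n) (suc n +ℕ 0)                      ≈⟨ +-identityˡ _ ⟩
      A (suc n) (suc n +ℕ 0)                           ≡⟨ ≡.cong (A (suc n)) (ℕP.+-identityʳ (suc n)) ⟩
      A (suc n) (suc n)                                ∎
    -- every old row j ≤ n gains the entry in column n+1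
    extendRow : ∀ j → j < suc n → inner j + A j (suc n) ≈ Σ< (suc (suc n ∸ j)) (λ m → A j (j +ℕ m))
    extendRow j (s≤s j≤n) = sym (begin
      Σ< (suc (suc n ∸ j)) (λ m → A j (j +ℕ m))   ≡⟨ ≡.cong (λ r → Σ< (suc r) (λ m → A j (j +ℕ m))) (ℕP.+-∸-assoc 1 j≤n) ⟩
      inner j + A j (j +ℕ suc (n ∸ j))            ≡⟨ ≡.cong (λ r → inner j + A j r) j+[n+1-j]≡n+1 ⟩
      inner j + A j (suc n)                       ∎)
      where
      j+[n+1-j]≡n+1 : j +ℕ suc (n ∸ j) ≡ suc n
      j+[n+1-j]≡n+1 = ≡.trans (ℕP.+-suc j (n ∸ j)) (≡.cong suc (ℕP.m+[n∸m]≡n j≤n))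

  ⊛-cong : ∀ {f f′ g g′} → f ≋ f′ → g ≋ g′ → (f ⊛ g) ≋ (f′ ⊛ g′)
  ⊛-cong ef eg n = Σ-cong (suc n) (λ i → *-cong (ef i) (eg (n ∸ i)))

  ⊛-congʳ : ∀ {f f′} g → f ≋ f′ → (f ⊛ g) ≋ (f′ ⊛ g)
  ⊛-congʳ g ef = ⊛-cong {g = g} ef (λ _ → refl)

  ⊛-comm : ∀ f g → (f ⊛ g) ≋ (g ⊛ f)
  ⊛-comm f g n = begin
    Σ< (suc n) (λ i → f i * g (n ∸ i))             ≈⟨ Σ-reverse (suc n) _ ⟩
    Σ< (suc n) (λ i → f (n ∸ i) * g (n ∸ (n ∸ i))) ≈⟨ Σ-cong< (suc n) (λ i i≤n → *-comm _ _) ⟩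
    Σ< (suc n) (λ i → g (n ∸ (n ∸ i)) * f (n ∸ i)) ≈⟨ Σ-cong< (suc n) (λ i i≤n →
                                                         *-congʳ (reflexive (≡.cong g (ℕP.m∸[m∸n]≡n (ℕP.≤-pred i≤n))))) ⟩
    Σ< (suc n) (λ i → g i * f (n ∸ i))             ∎

  ⊛-assoc : ∀ f g h → ((f ⊛ g) ⊛ h) ≋ (f ⊛ (g ⊛ h))
  ⊛-assoc f g h n = begin
    Σ< (suc n) (λ i → Σ< (suc i) (λ j → f j * g (i ∸ j)) * h (n ∸ i))
      ≈⟨ Σ-cong (suc n) (λ i → Σ-*ʳ (suc i) _ _) ⟩
    Σ< (suc n) (λ i → Σ< (suc i) (λ j → f j * g (i ∸ j) * h (n ∸ i)))
      ≈⟨ Σ-triangle n (λ j i → f j * g (i ∸ j) * h (n ∸ i)) ⟩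
    Σ< (suc n) (λ j → Σ< (suc (n ∸ j)) (λ m → f j * g ((j +ℕ m) ∸ j) * h (n ∸ (j +ℕ m))))
      ≈⟨ Σ-cong (suc n) (λ j → Σ-cong (suc (n ∸ j)) (λ m → trans (*-assoc _ _ _)
           (*-congˡ (*-cong (reflexive (≡.cong g (ℕP.m+n∸m≡n j m)))
                            (reflexive (≡.cong h (≡.sym (ℕP.∸-+-assoc n j m)))))))) ⟩
    Σ< (suc n) (λ j → Σ< (suc (n ∸ j)) (λ m → f j * (g m * h ((n ∸ j) ∸ m))))
      ≈⟨ Σ-cong (suc n) (λ j → sym (Σ-*ˡ (suc (n ∸ j)) _ _)) ⟩
    Σ< (suc n) (λ j → f j * (g ⊛ h) (n ∸ j)) ∎

  ⊛-identityˡ : ∀ f → (oneS ⊛ f) ≋ f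
  ⊛-identityˡ f n = begin
    Σ< (suc n) (λ i → oneS i * f (n ∸ i))               ≈⟨ Σ-first n _ ⟩
    1# * f n + Σ< n (λ i → 0# * f (n ∸ suc i))           ≈⟨ +-cong (*-identityˡ _) (Σ-zero n (λ i → zeroˡ _)) ⟩
    f n + 0#                                             ≈⟨ +-identityʳ _ ⟩
    f n                                                  ∎

  ⊛-identityʳ : ∀ f → (f ⊛ oneS) ≋ f
  ⊛-identityʳ f n = trans (⊛-comm f oneS n) (⊛-identityˡ f n)

  onePlusT-⊛-zero : ∀ f → (onePlusT ⊛ f) 0 ≈ f 0
  onePlusT-⊛-zero f = trans (+-identityˡ _) (*-identityˡ _)

  onePlusT-⊛-suc : ∀ f l → (onePlusT ⊛ f) (suc l) ≈ f (suc l) + f l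
  onePlusT-⊛-suc f l = begin
    Σ< (suc (suc l)) (λ i → onePlusT i * f (suc l ∸ i))                ≈⟨ Σ-first (suc l) _ ⟩
    1# * f (suc l) + Σ< (suc l) (λ i → onePlusT (suc i) * f (l ∸ i))   ≈⟨ +-cong (*-identityˡ _) (Σ-first l _) ⟩
    f (suc l) + (1# * f l + Σ< l (λ i → 0# * f (l ∸ suc i)))           ≈⟨ +-congˡ (+-cong (*-identityˡ _) (Σ-zero l (λ i → zeroˡ _))) ⟩
    f (suc l) + (f l + 0#)                                             ≈⟨ +-congˡ (+-identityʳ _) ⟩
    f (suc l) + f l                                                    ∎

  powS-cong : ∀ {f g} → f ≋ g → ∀ r → powS f r ≋ powS g r
  powS-cong e zero    n = refl
  powS-cong e (suc r)   = ⊛-cong e (powS-cong e r)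

  inv-cong : ∀ {x y} → x ≈ y → ¬ x ≈ 0# → inv x ≈ inv y
  inv-cong {x} {y} x≈y x≉0 = begin
    inv x               ≈⟨ *-identityʳ _ ⟨
    inv x * 1#          ≈⟨ *-congˡ (inv-law y (λ y≈0 → x≉0 (trans x≈y y≈0))) ⟨
    inv x * (y * inv y) ≈⟨ *-assoc _ _ _ ⟨
    (inv x * y) * inv y ≈⟨ *-congʳ (trans (*-congˡ (sym x≈y)) (trans (*-comm _ _) (inv-law x x≉0))) ⟩
    1# * inv y          ≈⟨ *-identityˡ _ ⟩
    inv y               ∎

  recipPre-stable : ∀ g n m → m ≤ n → recipPre g n m ≡ recip g m
  recipPre-stable g zero    .zero z≤n = ≡.refl
  recipPre-stable g (suc n) m m≤1+n with ℕP.m≤n⇒m<n∨m≡n m≤1+n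
  ... | inj₂ ≡.refl = ≡.refl
  ... | inj₁ (s≤s m≤n) with m ℕ.≤? n
  ...   | yes _   = recipPre-stable g n m m≤n
  ...   | no m≰n  = ⊥-elim (m≰n m≤n)

  recip-suc : ∀ g n → recip g (suc n) ≈ - (inv (g 0) * Σ< (suc n) (λ j → g (suc j) * recip g (n ∸ j)))
  recip-suc g n with suc n ℕ.≤? n
  ... | yes 1+n≤n = ⊥-elim (ℕP.1+n≰n 1+n≤n)
  ... | no _      = -‿cong (*-congˡ (Σ-cong (suc n) (λ j →
                      *-congˡ (reflexive (recipPre-stable g n (n ∸ j) (ℕP.m∸n≤m n j))))))

  recip-inverse : ∀ g → ¬ g 0 ≈ 0# → (g ⊛ recip g) ≋ oneS
  recip-inverse g g₀≉0 zero    = trans (+-identityˡ _) (inv-law (g 0) g₀≉0)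
  recip-inverse g g₀≉0 (suc n) = begin
    Σ< (suc (suc n)) (λ i → g i * recip g (suc n ∸ i)) ≈⟨ Σ-first (suc n) _ ⟩
    g 0 * recip g (suc n) + X                          ≈⟨ +-congʳ (*-congˡ (recip-suc g n)) ⟩
    g 0 * - (inv (g 0) * X) + X                        ≈⟨ +-congʳ (-‿distribʳ-* _ _) ⟨
    - (g 0 * (inv (g 0) * X)) + X                      ≈⟨ +-congʳ (-‿cong (trans (sym (*-assoc _ _ _)) (trans (*-congʳ (inv-law (g 0) g₀≉0)) (*-identityˡ X)))) ⟩
    - X + X                                            ≈⟨ -‿inverseˡ X ⟩
    0#                                                 ∎
    where
    X : Carrier
    X = Σ< (suc n) (λ j → g (suc j) * recip g (n ∸ j))

  -- Uniqueness of inverses: s = s (g r) = (g s) r = r.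
  recip-unique : ∀ g s → ¬ g 0 ≈ 0# → (g ⊛ s) ≋ oneS → s ≋ recip g
  recip-unique g s g₀≉0 gs≋1 n = begin
    s n                           ≈⟨ ⊛-identityʳ s n ⟨
    (s ⊛ oneS) n                  ≈⟨ ⊛-cong (λ _ → refl) (recip-inverse g g₀≉0) n ⟨
    (s ⊛ (g ⊛ recip g)) n         ≈⟨ ⊛-assoc s g (recip g) n ⟨
    ((s ⊛ g) ⊛ recip g) n         ≈⟨ ⊛-congʳ (recip g) (λ m → trans (⊛-comm s g m) (gs≋1 m)) n ⟩
    (oneS ⊛ recip g) n            ≈⟨ ⊛-identityˡ (recip g) n ⟩
    recip g n                     ∎

  recip-cong : ∀ {g g′} → g ≋ g′ → ¬ g 0 ≈ 0# → recip g′ ≋ recip g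
  recip-cong {g} {g′} e g₀≉0 = recip-unique g (recip g′) g₀≉0 λ n →
    trans (⊛-congʳ (recip g′) e n) (recip-inverse g′ (λ g′₀≈0 → g₀≉0 (trans (e 0) g′₀≈0)) n)

  -- The embedding of ℕ is the library's n × 1#, so it is a semiring map.
  fromℕK≡× : ∀ n → fromℕK n ≡ n × 1#
  fromℕK≡× zero    = ≡.refl
  fromℕK≡× (suc n) = ≡.cong (1# +_) (fromℕK≡× n)

  fromℕK-+ : ∀ m n → fromℕK (m +ℕ n) ≈ fromℕK m + fromℕK n
  fromℕK-+ m n rewrite fromℕK≡× (m +ℕ n) | fromℕK≡× m | fromℕK≡× n = ×-homo-+ 1# m n

  fromℕK-* : ∀ m n → fromℕK (m *ℕ n) ≈ fromℕK m * fromℕK n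
  fromℕK-* m n rewrite fromℕK≡× (m *ℕ n) | fromℕK≡× m | fromℕK≡× n = ×1-homo-* m n

  fromℕK-suc-1 : ∀ n → fromℕK (suc n) - 1# ≈ fromℕK n
  fromℕK-suc-1 n = trans (+-congʳ (+-comm 1# _)) (//-rightDividesʳ 1# (fromℕK n))

  1≉0 : ¬ 1# ≈ 0#
  1≉0 1≈0 = charZero 0 (trans (+-identityʳ 1#) 1≈0)

  inv-1 : inv 1# ≈ 1#
  inv-1 = trans (sym (*-identityˡ _)) (inv-law 1# 1≉0)

  falling-cong : ∀ {x y} → x ≈ y → ∀ l → falling x l ≈ falling y l
  falling-cong e zero    = refl
  falling-cong e (suc l) = *-cong (falling-cong e l) (+-congʳ e)

  falling-shift : ∀ x l → falling x (suc l) ≈ x * falling (x - 1#) l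
  falling-shift x zero = begin
    1# * (x - 0#) ≈⟨ *-identityˡ _ ⟩
    x - 0#        ≈⟨ trans (+-congˡ ε⁻¹≈ε) (+-identityʳ x) ⟩
    x             ≈⟨ *-identityʳ x ⟨
    x * 1#        ∎
  falling-shift x (suc l) = begin
    falling x (suc l) * (x - fromℕK (suc l))            ≈⟨ *-cong (falling-shift x l) (+-congˡ (sym (⁻¹-∙-comm 1# _))) ⟩
    (x * falling (x - 1#) l) * (x + (- 1# + - fromℕK l)) ≈⟨ *-assoc _ _ _ ⟩
    x * (falling (x - 1#) l * (x + (- 1# + - fromℕK l))) ≈⟨ *-congˡ (*-congˡ (+-assoc _ _ _)) ⟨
    x * (falling (x - 1#) l * ((x - 1#) - fromℕK l))    ∎

  -- The ring identity behind the recurrence of negBinomial below.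
  cancel-scaled : ∀ s x z B → (- s) * ((x + z) * B) + z * (s * B) ≈ (- s) * (B * x)
  cancel-scaled s x z B = begin
    (- s) * ((x + z) * B) + z * (s * B)        ≈⟨ +-cong (sym (-‿distribˡ-* _ _)) (*-comm _ _) ⟩
    - (s * ((x + z) * B)) + u * z              ≈⟨ +-congʳ (-‿cong (trans (*-congˡ (*-comm _ _)) (sym (*-assoc _ _ _)))) ⟩
    - (u * (x + z)) + u * z                    ≈⟨ +-congʳ (-‿cong (distribˡ u x z)) ⟩
    - (u * x + u * z) + u * z                  ≈⟨ +-congʳ (⁻¹-∙-comm _ _) ⟨
    (- (u * x) + - (u * z)) + u * z            ≈⟨ //-rightDividesˡ (u * z) (- (u * x)) ⟩
    - (u * x)                                  ≈⟨ -‿cong (*-assoc _ _ _) ⟩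
    - (s * (B * x))                            ≈⟨ -‿distribˡ-* _ _ ⟩
    (- s) * (B * x)                            ∎
    where
    u : Carrier
    u = s * B

  invPowOnePlusT : ℕ → Series
  invPowOnePlusT N = recip (powS onePlusT N)

  -- l! [t^l] (1+t)^(-N) is claimed to be (-1)^l (N+l-1)_l.
  negBinomial : ℕ → ℕ → Carrier
  negBinomial N l = sgn l * falling (fromℕK (N +ℕ l) - 1#) l

  powOnePlusT-zero : ∀ N → powS onePlusT N 0 ≈ 1#
  powOnePlusT-zero zero    = refl
  powOnePlusT-zero (suc N) = trans (onePlusT-⊛-zero (powS onePlusT N)) (powOnePlusT-zero N)

  powOnePlusT-zero≉0 : ∀ N → ¬ powS onePlusT N 0 ≈ 0#
  powOnePlusT-zero≉0 N e = 1≉0 (trans (sym (powOnePlusT-zero N)) e)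

  invPowOnePlusT-step : ∀ N → (onePlusT ⊛ invPowOnePlusT (suc N)) ≋ invPowOnePlusT N
  invPowOnePlusT-step N = recip-unique P (onePlusT ⊛ invPowOnePlusT (suc N)) (powOnePlusT-zero≉0 N) λ n → begin
    (P ⊛ (onePlusT ⊛ invPowOnePlusT (suc N))) n  ≈⟨ ⊛-assoc P onePlusT (invPowOnePlusT (suc N)) n ⟨
    ((P ⊛ onePlusT) ⊛ invPowOnePlusT (suc N)) n  ≈⟨ ⊛-congʳ (invPowOnePlusT (suc N)) (⊛-comm P onePlusT) n ⟩
    (powS onePlusT (suc N) ⊛ invPowOnePlusT (suc N)) n
      ≈⟨ recip-inverse (powS onePlusT (suc N)) (powOnePlusT-zero≉0 (suc N)) n ⟩
    oneS n                                       ∎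
    where
    P : Series
    P = powS onePlusT N

  invPowOnePlusT-zero : invPowOnePlusT 0 ≋ oneS
  invPowOnePlusT-zero n = sym (recip-unique oneS oneS 1≉0 (⊛-identityˡ oneS) n)

  -- Multiplying invPowOnePlusT-step by (l+1)!:
  --   c_(N+1)(l+1) + (l+1) c_(N+1)(l) = c_N(l+1)   where c_N(l) = l! [t^l] (1+t)^(-N).
  invPowOnePlusT-recurrence : ∀ N l →
    fromℕK (suc l !) * invPowOnePlusT (suc N) (suc l) + fromℕK (suc l) * (fromℕK (l !) * invPowOnePlusT (suc N) l)
      ≈ fromℕK (suc l !) * invPowOnePlusT N (suc l)
  invPowOnePlusT-recurrence N l = begin
    fromℕK (suc l !) * R (suc l) + fromℕK (suc l) * (fromℕK (l !) * R l)
      ≈⟨ +-congˡ (sym (*-assoc _ _ _)) ⟩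
    fromℕK (suc l !) * R (suc l) + (fromℕK (suc l) * fromℕK (l !)) * R l
      ≈⟨ +-congˡ (*-congʳ (sym (fromℕK-* (suc l) (l !)))) ⟩
    fromℕK (suc l !) * R (suc l) + fromℕK (suc l !) * R l
      ≈⟨ distribˡ _ _ _ ⟨
    fromℕK (suc l !) * (R (suc l) + R l)
      ≈⟨ *-congˡ (trans (sym (onePlusT-⊛-suc R l)) (invPowOnePlusT-step N (suc l))) ⟩
    fromℕK (suc l !) * invPowOnePlusT N (suc l) ∎
    where
    R : Series
    R = invPowOnePlusT (suc N)

  negBinomial-recurrence : ∀ N l →
    negBinomial (suc N) (suc l) + fromℕK (suc l) * negBinomial (suc N) l ≈ negBinomial N (suc l)
  negBinomial-recurrence N l = begin
    (- s) * falling (fromℕK (suc N +ℕ suc l) - 1#) (suc l) + fromℕK (suc l) * (s * falling (fromℕK (suc N +ℕ l) - 1#) l)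
      ≈⟨ +-cong (*-congˡ (falling-cong (fromℕK-suc-1 (N +ℕ suc l)) (suc l))) (*-congˡ (*-congˡ (falling-cong (fromℕK-suc-1 (N +ℕ l)) l))) ⟩
    (- s) * falling X (suc l) + fromℕK (suc l) * (s * B)
      ≈⟨ +-congʳ (*-congˡ (trans (falling-shift X l) (*-cong (fromℕK-+ N (suc l)) (falling-cong X-1≈Y l)))) ⟩
    (- s) * ((fromℕK N + fromℕK (suc l)) * B) + fromℕK (suc l) * (s * B)
      ≈⟨ cancel-scaled s (fromℕK N) (fromℕK (suc l)) B ⟩
    (- s) * (B * fromℕK N)
      ≈⟨ *-congˡ (*-congˡ (trans (+-congʳ (fromℕK-+ N l)) (//-rightDividesʳ (fromℕK l) (fromℕK N)))) ⟨
    (- s) * (B * (Y - fromℕK l))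
      ≈⟨ *-congˡ (*-cong (falling-cong X-1≈Y l) (+-congʳ X-1≈Y)) ⟨
    (- s) * falling (X - 1#) (suc l) ∎
    where
    s X Y B : Carrier
    s = sgn l
    X = fromℕK (N +ℕ suc l)
    Y = fromℕK (N +ℕ l)
    B = falling Y l
    X-1≈Y : X - 1# ≈ Y
    X-1≈Y = trans (+-congʳ (reflexive (≡.cong fromℕK (ℕP.+-suc N l)))) (fromℕK-suc-1 (N +ℕ l))

  invPowOnePlusT-coefficient : ∀ N l → fromℕK (l !) * invPowOnePlusT N l ≈ negBinomial N l
  invPowOnePlusT-coefficient zero zero = *-cong (+-identityʳ 1#) (invPowOnePlusT-zero 0)
  invPowOnePlusT-coefficient zero (suc l) = begin
    fromℕK (suc l !) * invPowOnePlusT 0 (suc l) ≈⟨ *-congˡ (invPowOnePlusT-zero (suc l)) ⟩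
    fromℕK (suc l !) * 0#                       ≈⟨ zeroʳ _ ⟩
    0#                                          ≈⟨ trans (*-congˡ (zeroʳ _)) (zeroʳ _) ⟨
    (- sgn l) * (falling x l * 0#)              ≈⟨ *-congˡ (*-congˡ (-‿inverseʳ (fromℕK l))) ⟨
    (- sgn l) * (falling x l * (fromℕK l - fromℕK l)) ≈⟨ *-congˡ (*-congˡ (+-congʳ (fromℕK-suc-1 l))) ⟨
    (- sgn l) * (falling x l * (x - fromℕK l))  ∎
    where
    x : Carrier
    x = fromℕK (suc l) - 1#
  invPowOnePlusT-coefficient (suc N) zero = begin
    fromℕK 1 * invPowOnePlusT (suc N) 0 ≈⟨ *-congˡ (trans (sym (onePlusT-⊛-zero (invPowOnePlusT (suc N)))) (invPowOnePlusT-step N 0)) ⟩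
    fromℕK 1 * invPowOnePlusT N 0       ≈⟨ invPowOnePlusT-coefficient N 0 ⟩
    negBinomial N 0                     ∎
  -- both sides satisfy the same recurrence; cancel its second summand
  invPowOnePlusT-coefficient (suc N) (suc l) =
    ∙-cancelʳ (fromℕK (suc l) * negBinomial (suc N) l) _ _ (begin
      fromℕK (suc l !) * invPowOnePlusT (suc N) (suc l) + fromℕK (suc l) * negBinomial (suc N) l
        ≈⟨ +-congˡ (*-congˡ (invPowOnePlusT-coefficient (suc N) l)) ⟨
      fromℕK (suc l !) * invPowOnePlusT (suc N) (suc l) + fromℕK (suc l) * (fromℕK (l !) * invPowOnePlusT (suc N) l)
        ≈⟨ invPowOnePlusT-recurrence N l ⟩
      fromℕK (suc l !) * invPowOnePlusT N (suc l)
        ≈⟨ invPowOnePlusT-coefficient N (suc l) ⟩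
      negBinomial N (suc l)
        ≈⟨ negBinomial-recurrence N l ⟨
      negBinomial (suc N) (suc l) + fromℕK (suc l) * negBinomial (suc N) l ∎)

  egf-convolution : ∀ f g k →
    fromℕK (k !) * (f ⊛ g) k ≈
    Σ< (suc k) (λ l → (fromℕK (k C l) * (fromℕK (l !) * f l)) * (fromℕK ((k ∸ l) !) * g (k ∸ l)))
  egf-convolution f g k = trans (Σ-*ˡ (suc k) _ _) (Σ-cong< (suc k) term)
    where
    term : ∀ l → l < suc k → fromℕK (k !) * (f l * g (k ∸ l)) ≈
           (fromℕK (k C l) * (fromℕK (l !) * f l)) * (fromℕK ((k ∸ l) !) * g (k ∸ l))
    term l (s≤s l≤k) = begin
      fromℕK (k !) * (f l * g (k ∸ l))
        ≈⟨ *-congʳ (trans (reflexive (≡.cong fromℕK (factorial-split l≤k)))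
                          (trans (fromℕK-* ((k C l) *ℕ l !) ((k ∸ l) !)) (*-congʳ (fromℕK-* (k C l) (l !))))) ⟩
      ((fromℕK (k C l) * fromℕK (l !)) * fromℕK ((k ∸ l) !)) * (f l * g (k ∸ l))
        ≈⟨ *-interchange _ _ _ _ ⟩
      ((fromℕK (k C l) * fromℕK (l !)) * f l) * (fromℕK ((k ∸ l) !) * g (k ∸ l))
        ≈⟨ *-congʳ (*-assoc _ _ _) ⟩
      (fromℕK (k C l) * (fromℕK (l !) * f l)) * (fromℕK ((k ∸ l) !) * g (k ∸ l)) ∎

  egf-derivN : ∀ N f k → fromℕK (k !) * derivN N f k ≈ fromℕK ((k +ℕ N) !) * f (k +ℕ N)
  egf-derivN zero    f k = reflexive (≡.cong (λ j → fromℕK (j !) * f j) (≡.sym (ℕP.+-identityʳ k)))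
  egf-derivN (suc N) f k = begin
    fromℕK (k !) * (fromℕK (suc k) * derivN N f (suc k)) ≈⟨ *-left-swap _ _ _ ⟩
    fromℕK (suc k) * (fromℕK (k !) * derivN N f (suc k)) ≈⟨ *-assoc _ _ _ ⟨
    (fromℕK (suc k) * fromℕK (k !)) * derivN N f (suc k) ≈⟨ *-congʳ (fromℕK-* (suc k) (k !)) ⟨
    fromℕK (suc k !) * derivN N f (suc k)                ≈⟨ egf-derivN N f (suc k) ⟩
    fromℕK ((suc k +ℕ N) !) * f (suc k +ℕ N)             ≡⟨ ≡.cong (λ j → fromℕK (j !) * f j) (≡.sym (ℕP.+-suc k N)) ⟩
    fromℕK ((k +ℕ suc N) !) * f (k +ℕ suc N)             ∎

  -- F is the reciprocal 1/(1 + (1+t)^λ) used to define the higher-order Boole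
  -- numbers; its constant term is 1/2, and 2 ≠ 0 by characteristic zero.
  F≋recip : ∀ lam → F lam ≋ recip (oneS ⊕ binSeries lam)
  F≋recip lam = recip-cong (λ n → +-comm _ _) constant≉0
    where
    binom-zero : binom lam 0 ≈ 1#
    binom-zero = trans (*-identityˡ _) (trans (inv-cong (+-identityʳ 1#) (charZero 0)) inv-1)
    constant≉0 : ¬ oneS 0 + binom lam 0 ≈ 0#
    constant≉0 e = charZero 1 (trans (+-congˡ (trans (+-identityʳ 1#) (sym binom-zero))) e)

  egf-F-power : ∀ lam r m → fromℕK (m !) * powS (F lam) r m ≈ BlHigh r m lam
  egf-F-power lam r m = *-congˡ (powS-cong (F≋recip lam) r m)

theorem3 : ∀ {c ℓ : Level} (K : CharZeroField c ℓ) →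
    let open CharZeroField K in
    let open Series K in
    (lam : Carrier) → ¬ (lam ≈ 0#) →
    (N : ℕ) → (a : ℕ → Carrier) →
    derivN N (F lam) ≋ ((sgn N * lam) · (recip (powS onePlusT N) ⊛ (λ n → Σ< (suc N) (λ i → a i * powS (F lam) (suc i) n)))) →
    (k : ℕ) →
    Bl (k +ℕ N) lam ≈ sgn N * lam * Σ< (suc N) (λ i → a i * Σ< (suc k) (λ l → fromℕK (k C l) * sgn l * falling (fromℕK (N +ℕ l) - 1#) l * BlHigh (suc i) (k ∸ l) lam))
theorem3 K lam _ N a hyp k = begin
  fromℕK ((k +ℕ N) !) * F lam (k +ℕ N)              ≈⟨ egf-derivN N (F lam) k ⟨
  fromℕK (k !) * derivN N (F lam) k                 ≈⟨ *-congˡ (hyp k) ⟩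
  fromℕK (k !) * (c * (invPowOnePlusT N ⊛ G) k)     ≈⟨ *-left-swap _ _ _ ⟩
  c * (fromℕK (k !) * (invPowOnePlusT N ⊛ G) k)     ≈⟨ *-congˡ (egf-convolution (invPowOnePlusT N) G k) ⟩
  c * Σ< (suc k) (λ l → (fromℕK (k C l) * (fromℕK (l !) * invPowOnePlusT N l)) * (fromℕK ((k ∸ l) !) * G (k ∸ l)))
    ≈⟨ *-congˡ (Σ-cong (suc k) (λ l → *-cong (*-congˡ (invPowOnePlusT-coefficient N l)) (egf-G (k ∸ l)))) ⟩
  c * Σ< (suc k) (λ l → (fromℕK (k C l) * negBinomial N l) * Σ< (suc N) (λ i → a i * BH i (k ∸ l)))
    ≈⟨ *-congˡ (Σ-swap-weighted (suc N) (suc k) _ a (λ i l → BH i (k ∸ l))) ⟩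
  c * Σ< (suc N) (λ i → a i * Σ< (suc k) (λ l → (fromℕK (k C l) * negBinomial N l) * BH i (k ∸ l)))
    ≈⟨ *-congˡ (Σ-cong (suc N) (λ i → *-congˡ (Σ-cong (suc k) (λ l → *-congʳ (sym (*-assoc _ _ _)))))) ⟩
  c * Σ< (suc N) (λ i → a i * Σ< (suc k) (λ l → fromℕK (k C l) * sgn l * falling (fromℕK (N +ℕ l) - 1#) l * BH i (k ∸ l))) ∎
  where
  open CharZeroField K hiding (zero)
  open Series K
  open Development K
  open import Relation.Binary.Reasoning.Setoid setoid
  open CommutativeSemigroupProperties *-commutativeSemigroup using () renaming (x∙yz≈y∙xz to *-left-swap)
  c : Carrier
  c = sgn N * lam
  G : Series
  G n = Σ< (suc N) (λ i → a i * powS (F lam) (suc i) n)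
  BH : ℕ → ℕ → Carrier
  BH i m = BlHigh (suc i) m lam
  egf-G : ∀ m → fromℕK (m !) * G m ≈ Σ< (suc N) (λ i → a i * BH i m)
  egf-G m = trans (Σ-*ˡ (suc N) _ _) (Σ-cong (suc N) (λ i → trans (*-left-swap _ _ _) (*-congˡ (egf-F-power lam (suc i) m))))
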